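{- Let $a\ge3$ be an integer and define $(h_{a,1}(n))_{n\in\mathbb{N}}$ by $h_{a,1}(n)=a$ for integers $n\le0$, $h_{a,1}(1)=1$, and $h_{a,1}(n)=h_{a,1}(n-h_{a,1}(n-1))+h_{a,1}(n-2)$ for $n>1$. Then $h_{a,1}(0)=a$ and for all $n\in\mathbb{N}_+$, $$h_{a,1}(n)=\left\lfloor \frac n2\right\rfloor a+1.$$ -}

module Defs where

open import Data.Nat using (ℕ)
open import Data.Integer using (ℤ; +_; _+_; _-_; _≤_; _>_; 1ℤ; 0ℤ)

-- The (a priori partial) sequence h_{a,1} : ℤ → ℤ, given by its graph.
-- HA a n v  means "h_{a,1}(n) is defined (the recursion terminates) and equals v".
data HA (a : ℕ) : ℤ → ℤ → Set where
  h-nonpos : ∀ {n} → n ≤ 0ℤ → HA a n (+ a)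
  h-one    : HA a 1ℤ 1ℤ
  h-rec    : ∀ {n u w v} → n > 1ℤ →
             HA a (n - 1ℤ) u →
             HA a (n - + 2) w →
             HA a (n - u) v →
             HA a n (v + w)

{-# OPTIONS --safe #-}
-- The closed form h is a solution of the recursion, and any solution agrees with
-- every derivation, so h(n) is the only possible value.  For n ≥ 3 the bound
-- h(n-1) ≥ n (this is where a ≥ 3 enters) makes n - h(n-1) ≤ 0, so the
-- recursion degenerates to h(n) = a + h(n-2), which the closed form satisfies.
module Submission where

open import Defs
open import Data.Nat using (ℕ; _≥_; _/_; _*_; _+_; zero; suc; s≤s; z≤n)
import Data.Nat as ℕ
import Data.Nat.Properties as ℕ
open import Data.Nat.DivMod using (m/n≡1+[m∸n]/n)
open import Data.Integer using (ℤ; +_; -[1+_]; +≤+; +<+; 0ℤ; 1ℤ)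
import Data.Integer as ℤ
import Data.Integer.Properties as ℤ
open import Data.Product using (_×_; _,_; proj₁)
open import Relation.Binary.PropositionalEquality

HA-functional : ∀ {a} (f : ℤ → ℤ) →
  (∀ {n} → n ℤ.≤ 0ℤ → f n ≡ + a) →
  f 1ℤ ≡ 1ℤ →
  (∀ {n} → n ℤ.> 1ℤ → f n ≡ f (n ℤ.- f (n ℤ.- 1ℤ)) ℤ.+ f (n ℤ.- + 2)) →
  ∀ {n v} → HA a n v → v ≡ f n
HA-functional f f-nonpos f-one f-rec (h-nonpos n≤0) = sym (f-nonpos n≤0)
HA-functional f f-nonpos f-one f-rec h-one          = sym f-one
HA-functional f f-nonpos f-one f-rec (h-rec n>1 dn-1 dn-2 dn-u)
  with refl ← HA-functional f f-nonpos f-one f-rec dn-1 =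
  trans (cong₂ ℤ._+_ (HA-functional f f-nonpos f-one f-rec dn-u)
                     (HA-functional f f-nonpos f-one f-rec dn-2))
        (sym (f-rec n>1))

module _ (a : ℕ) where

  h⁺ : ℕ → ℕ
  h⁺ zero          = 1
  h⁺ (suc zero)    = 1
  h⁺ (suc (suc m)) = a + h⁺ m

  h⁺≡⌊n/2⌋*a+1 : ∀ n → h⁺ n ≡ n / 2 * a + 1
  h⁺≡⌊n/2⌋*a+1 zero          = refl
  h⁺≡⌊n/2⌋*a+1 (suc zero)    = refl
  h⁺≡⌊n/2⌋*a+1 (suc (suc m)) = begin
    a + h⁺ m                ≡⟨ cong (λ q → a + q) (h⁺≡⌊n/2⌋*a+1 m) ⟩
    a + (m / 2 * a + 1)     ≡⟨ ℕ.+-assoc a (m / 2 * a) 1 ⟨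
    suc (m / 2) * a + 1     ≡⟨ cong (λ q → q * a + 1) (m/n≡1+[m∸n]/n {suc (suc m)} {2} (s≤s (s≤s z≤n))) ⟨
    suc (suc m) / 2 * a + 1 ∎
    where open ≡-Reasoning

  h : ℤ → ℤ
  h (+ suc m) = + h⁺ (suc m)
  h _         = + a

  h-nonpositive : ∀ {n} → n ℤ.≤ 0ℤ → h n ≡ + a
  h-nonpositive {+ zero}    _        = refl
  h-nonpositive {+ suc m}   (+≤+ ())
  h-nonpositive { -[1+ m ]} _        = refl

  module _ (a≥3 : a ≥ 3) where

    n+3≤h⁺[2+n] : ∀ n → n + 3 ℕ.≤ h⁺ (suc (suc n))
    n+3≤h⁺[2+n] zero          = ℕ.+-monoˡ-≤ 1 (ℕ.≤-trans (s≤s (s≤s z≤n)) a≥3)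
    n+3≤h⁺[2+n] (suc zero)    = ℕ.+-monoˡ-≤ 1 a≥3
    n+3≤h⁺[2+n] (suc (suc n)) = ℕ.≤-trans (s≤s (s≤s (n+3≤h⁺[2+n] n)))
      (ℕ.+-monoˡ-≤ (a + h⁺ n) (ℕ.≤-trans (s≤s (s≤s z≤n)) a≥3))

    lookback-nonpositive : ∀ n → + (3 + n) ℤ.- + h⁺ (2 + n) ℤ.≤ 0ℤ
    lookback-nonpositive n =
      ℤ.i≤j⇒i-j≤0 (+≤+ (subst (ℕ._≤ h⁺ (2 + n)) (ℕ.+-comm n 3) (n+3≤h⁺[2+n] n)))

    h-recursion : ∀ {n} → n ℤ.> 1ℤ → h n ≡ h (n ℤ.- h (n ℤ.- 1ℤ)) ℤ.+ h (n ℤ.- + 2)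
    h-recursion {+ zero}              (+<+ ())
    h-recursion {+ suc zero}          (+<+ (s≤s ()))
    h-recursion { -[1+ _ ]}           ()
    h-recursion {+ suc (suc zero)}    _ = cong +_ (ℕ.+-comm a 1)
    h-recursion {+ suc (suc (suc m))} _ =
      cong (ℤ._+ + h⁺ (suc m)) (sym (h-nonpositive (lookback-nonpositive m)))

    HA-h⁺ : ∀ n → HA a (+ suc n) (+ h⁺ (suc n)) × HA a (+ suc (suc n)) (+ h⁺ (suc (suc n)))
    HA-h⁺ zero = h-one , subst (HA a (+ 2)) (cong +_ (ℕ.+-comm 1 a))
                           (h-rec (+<+ (s≤s (s≤s z≤n))) h-one (h-nonpos (+≤+ z≤n)) h-one)
    HA-h⁺ (suc n) with HA-h⁺ n
    ... | d₁ , d₂ = d₂ , h-rec (+<+ (s≤s (s≤s z≤n))) d₂ d₁ (h-nonpos (lookback-nonpositive n))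

    HA⇒≡h : ∀ {n v} → HA a n v → v ≡ h n
    HA⇒≡h = HA-functional h h-nonpositive refl h-recursion

theorem5p2 : (a : ℕ) → a ≥ 3 →
    (HA a (+ 0) (+ a) × (∀ v → HA a (+ 0) v → v ≡ + a)) ×
    (∀ (n : ℕ) → n ≥ 1 →
      HA a (+ n) (+ ((n / 2) * a + 1)) × (∀ v → HA a (+ n) v → v ≡ + ((n / 2) * a + 1)))
theorem5p2 a a≥3 = (h-nonpos (+≤+ z≤n) , λ _ → HA⇒≡h a a≥3) , positive
  where
  positive : ∀ n → n ≥ 1 →
    HA a (+ n) (+ (n / 2 * a + 1)) × (∀ v → HA a (+ n) v → v ≡ + (n / 2 * a + 1))
  positive (suc m) _ rewrite sym (h⁺≡⌊n/2⌋*a+1 a (suc m)) =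
    proj₁ (HA-h⁺ a a≥3 m) , λ _ → HA⇒≡h a a≥3
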